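{- For a many-sorted finite model finding instance $P$, the set $\mathrm{ConDomSym}(P)^{\mathcal F}=\{\sigma^{\mathcal F}:\sigma\in\mathrm{ConDomSym}(P)\}$ is a subgroup of $\mathrm{ConSym}(P_{\mathrm{FCSP}})$.
   Context: MSFMF setting: a signature $\Sigma$ has finitely many sorts, function symbols $f:A_1\times\dots\times A_n\to B$ and predicate symbols $R:A_1\times\dots\times A_n\to\mathrm{Bool}$; a domain assignment $\mathcal U$ maps sorts to nonempty finite sets; $P=(\Sigma,\Gamma,\mathcal U)$ with $\Gamma$ a finite set of many-sorted first-order formulas with equality in which domain values $v\in\mathcal U(\theta)$ may appear as terms of sort $\theta$. A domain permutation $\sigma$ is a family of permutations $\sigma_\theta$ of $\mathcal U(\theta)$. It acts on a formula $\Phi$ by replacing each occurrence of a domain element $d$ used as a term of sort $\theta$ by $\sigma_\theta(d)$, and $\sigma\bullet\Gamma=\{\sigma\bullet\Phi:\Phi\in\Gamma\}$. $\mathrm{ConDomSym}(P)$ is the set of domain permutations with $\sigma\bullet\Gamma=\Gamma$. CSP setting: a CSP $(X,D,C)$ has finite variable set $X$, each $x$ with nonempty finite domain $D(x)$, and finitely many constraints, each a scope with a relation of allowed tuples. Bindings are pairs $(x,v)$, $v\in D(x)$. The microstructure complement is the hypergraph with vertex set the bindings and hyperedges: $\{(x,a),(x,b)\}$ for each $x$ and distinct $a,b\in D(x)$, and $\{(x_1,a_1),\dots,(x_k,a_k)\}$ whenever $\{x_1,\dots,x_k\}$ is the variable set of some constraint's scope and that constraint disallows this assignment. $\mathrm{ConSym}$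 of a CSP is the group of automorphisms of its microstructure complement (permutations of bindings which, applied pointwise to sets, map hyperedges to hyperedges and non-hyperedges to non-hyperedges). Functional CSP $P_{\mathrm{FCSP}}$: variables are the function and predicate symbols of $\Sigma$; the domain of $f:A_1\times\dots\times A_n\to B$ is the set of all functions $\mathcal U(A_1)\times\dots\times\mathcal U(A_n)\to\mathcal U(B)$, and of $R$ the set of all relations $\subseteq\mathcal U(A_1)\times\dots\times\mathcal U(A_n)$; for each $\phi\in\Gamma$ there is one constraint whose scope is the symbols occurring in $\phi$ and which allows exactly those assignments under which $\phi$ is true. The functional extension $\sigma^{\mathcal F}$ of a domain permutation $\sigma$ maps the binding $(f,F)$ to $(f,F')$ with $F'(\sigma_{A_1}(a_1),\dots,\sigma_{A_n}(a_n))=\sigma_B(F(a_1,\dots,a_n))$, and $(R,\mathcal R)$ to $(R,\mathcal R')$ with $(a_1,\dots,a_n)\in\mathcal R\iff(\sigma_{A_1}(a_1),\dots,\sigma_{A_n}(a_n))\in\mathcal R'$. -}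

module Defs where

open import Data.Nat using (ℕ; NonZero; zero; suc)
open import Data.Fin as F using (Fin; _≟_)
open import Data.Bool using (Bool; true; false; not; _∧_; _∨_; if_then_else_)
open import Data.List using (List; []; _∷_; _++_)
open import Data.List.Membership.Propositional using (_∈_)
open import Data.List.Relation.Unary.All as All using (All; []; _∷_)
open import Data.Vec using (Vec; lookup; tabulate)
open import Data.Sum using (_⊎_; inj₁; inj₂)
open import Data.Product using (Σ; Σ-syntax; _×_; _,_)
open import Relation.Nullary using (¬_; does)
open import Relation.Binary.PropositionalEquality using (_≡_; _≢_)
open import Function.Bundles using (_↔_; _⇔_; Inverse)
open import Function.Construct.Identity using (↔-id)
open import Function.Construct.Composition using (_↔-∘_)
open import Function.Construct.Symmetry using (↔-sym)

record Signature : Set where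
  field
    nSorts : ℕ
    nFun   : ℕ
    nPred  : ℕ
    fArgs  : Fin nFun → List (Fin nSorts)
    fRes   : Fin nFun → Fin nSorts
    pArgs  : Fin nPred → List (Fin nSorts)

module MSFMF (Sig : Signature) (U : Fin (Signature.nSorts Sig) → ℕ) where
  open Signature Sig public

  Sort : Set
  Sort = Fin nSorts

  Dom : Sort → Set
  Dom θ = Fin (U θ)

  data Var : List Sort → Sort → Set where
    here  : ∀ {θ Δ} → Var (θ ∷ Δ) θ
    there : ∀ {θ θ' Δ} → Var Δ θ → Var (θ' ∷ Δ) θ

  mutual
    data Term (Δ : List Sort) : Sort → Set where
      var : ∀ {θ} → Var Δ θ → Term Δ θ
      val : ∀ {θ} → Dom θ → Term Δ θ
      app : (f : Fin nFun) → Terms Δ (fArgs f) → Term Δ (fRes f)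

    data Terms (Δ : List Sort) : List Sort → Set where
      []  : Terms Δ []
      _∷_ : ∀ {θ θs} → Term Δ θ → Terms Δ θs → Terms Δ (θ ∷ θs)

  data Formula (Δ : List Sort) : Set where
    tt ff    : Formula Δ
    _≐_      : ∀ {θ} → Term Δ θ → Term Δ θ → Formula Δ
    pred     : (r : Fin nPred) → Terms Δ (pArgs r) → Formula Δ
    ¬'_      : Formula Δ → Formula Δ
    _∧'_ _∨'_ _⇒'_ _⇔'_ : Formula Δ → Formula Δ → Formula Δ
    all' ex' : (θ : Sort) → Formula (θ ∷ Δ) → Formula Δ

  Sentence : Set
  Sentence = Formula []

  -- Symbols (= the variables of the functional CSP) and their values.

  Symbol : Set
  Symbol = Fin nFun ⊎ Fin nPred

  Tuple : List Sort → Set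
  Tuple = All Dom

  -- Finite tables indexed by tuples: an extensional representation of
  -- functions 𝒰(A₁)×…×𝒰(Aₙ) → B (curried, one Vec per argument).
  Table : List Sort → Set → Set
  Table []       B = B
  Table (a ∷ as) B = Vec (Table as B) (U a)

  at : ∀ {as B} → Table as B → Tuple as → B
  at {[]}     t []       = t
  at {a ∷ as} t (x ∷ xs) = at (lookup t x) xs

  tab : ∀ {as B} → (Tuple as → B) → Table as B
  tab {[]}     g = g []
  tab {a ∷ as} g = tabulate (λ x → tab (λ xs → g (x ∷ xs)))

  -- Domain of a CSP variable: all functions 𝒰(A₁)×…×𝒰(Aₙ) → 𝒰(B) for a
  -- function symbol; all relations ⊆ 𝒰(A₁)×…×𝒰(Aₙ) (as characteristic
  -- tables) for a predicate symbol.
  Value : Symbol → Set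
  Value (inj₁ f) = Table (fArgs f) (Dom (fRes f))
  Value (inj₂ r) = Table (pArgs r) Bool

  Binding : Set
  Binding = Σ Symbol Value

  -- A total assignment of values to all symbols (= a structure).
  Assignment : Set
  Assignment = (s : Symbol) → Value s

  -- Semantics (finite domains, so truth values are Booleans).

  lookupVar : ∀ {Δ θ} → Tuple Δ → Var Δ θ → Dom θ
  lookupVar (x ∷ _)  here      = x
  lookupVar (_ ∷ ρ)  (there v) = lookupVar ρ v

  mutual
    evalTerm : ∀ {Δ θ} → Assignment → Tuple Δ → Term Δ θ → Dom θ
    evalTerm α ρ (var v)    = lookupVar ρ v
    evalTerm α ρ (val d)    = d
    evalTerm α ρ (app f ts) = at {fArgs f} (α (inj₁ f)) (evalTerms α ρ ts)

    evalTerms : ∀ {Δ θs} → Assignment → Tuple Δ → Terms Δ θs → Tuple θs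
    evalTerms α ρ []       = []
    evalTerms α ρ (t ∷ ts) = evalTerm α ρ t ∷ evalTerms α ρ ts

  allFin : (n : ℕ) → (Fin n → Bool) → Bool
  allFin zero    p = true
  allFin ((suc n)) p = p F.zero ∧ allFin n (λ i → p (F.suc i))

  anyFin : (n : ℕ) → (Fin n → Bool) → Bool
  anyFin zero    p = false
  anyFin ((suc n)) p = p F.zero ∨ anyFin n (λ i → p (F.suc i))

  _⇔b_ : Bool → Bool → Bool
  true  ⇔b b = b
  false ⇔b b = not b

  eval : ∀ {Δ} → Assignment → Tuple Δ → Formula Δ → Bool
  eval α ρ tt          = true
  eval α ρ ff          = false
  eval α ρ (t ≐ u)     = does (evalTerm α ρ t ≟ evalTerm α ρ u)
  eval α ρ (pred r ts) = at {pArgs r} (α (inj₂ r)) (evalTerms α ρ ts)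
  eval α ρ (¬' φ)      = not (eval α ρ φ)
  eval α ρ (φ ∧' ψ)    = eval α ρ φ ∧ eval α ρ ψ
  eval α ρ (φ ∨' ψ)    = eval α ρ φ ∨ eval α ρ ψ
  eval α ρ (φ ⇒' ψ)    = not (eval α ρ φ) ∨ eval α ρ ψ
  eval α ρ (φ ⇔' ψ)    = eval α ρ φ ⇔b eval α ρ ψ
  eval α ρ (all' θ φ)  = allFin (U θ) (λ d → eval α (d ∷ ρ) φ)
  eval α ρ (ex' θ φ)   = anyFin (U θ) (λ d → eval α (d ∷ ρ) φ)

  -- Symbols occurring in a formula (the scope of its constraint).
  mutual
    symsT : ∀ {Δ θ} → Term Δ θ → List Symbol
    symsT (var _)    = []
    symsT (val _)    = []
    symsT (app f ts) = inj₁ f ∷ symsTs ts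

    symsTs : ∀ {Δ θs} → Terms Δ θs → List Symbol
    symsTs []       = []
    symsTs (t ∷ ts) = symsT t ++ symsTs ts

  syms : ∀ {Δ} → Formula Δ → List Symbol
  syms tt          = []
  syms ff          = []
  syms (t ≐ u)     = symsT t ++ symsT u
  syms (pred r ts) = inj₂ r ∷ symsTs ts
  syms (¬' φ)      = syms φ
  syms (φ ∧' ψ)    = syms φ ++ syms ψ
  syms (φ ∨' ψ)    = syms φ ++ syms ψ
  syms (φ ⇒' ψ)    = syms φ ++ syms ψ
  syms (φ ⇔' ψ)    = syms φ ++ syms ψ
  syms (all' θ φ)  = syms φ
  syms (ex' θ φ)   = syms φ

  DomPerm : Set
  DomPerm = (θ : Sort) → Dom θ ↔ Dom θ

  mutual
    actT : ∀ {Δ θ} → DomPerm → Term Δ θ → Term Δ θ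
    actT σ (var v)        = var v
    actT σ (val {θ} d)    = val (Inverse.to (σ θ) d)
    actT σ (app f ts)     = app f (actTs σ ts)

    actTs : ∀ {Δ θs} → DomPerm → Terms Δ θs → Terms Δ θs
    actTs σ []       = []
    actTs σ (t ∷ ts) = actT σ t ∷ actTs σ ts

  act : ∀ {Δ} → DomPerm → Formula Δ → Formula Δ
  act σ tt          = tt
  act σ ff          = ff
  act σ (t ≐ u)     = actT σ t ≐ actT σ u
  act σ (pred r ts) = pred r (actTs σ ts)
  act σ (¬' φ)      = ¬' act σ φ
  act σ (φ ∧' ψ)    = act σ φ ∧' act σ ψ
  act σ (φ ∨' ψ)    = act σ φ ∨' act σ ψ
  act σ (φ ⇒' ψ)    = act σ φ ⇒' act σ ψ
  act σ (φ ⇔' ψ)    = act σ φ ⇔' act σ ψ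
  act σ (all' θ φ)  = all' θ (act σ φ)
  act σ (ex' θ φ)   = ex' θ (act σ φ)

  invTuple : ∀ {as} → DomPerm → Tuple as → Tuple as
  invTuple σ = All.map (λ {θ} d → Inverse.from (σ θ) d)

  ext : DomPerm → Binding → Binding
  ext σ (inj₁ f , F) = inj₁ f , tab {fArgs f} (λ t → Inverse.to (σ (fRes f)) (at {fArgs f} F (invTuple σ t)))
  ext σ (inj₂ r , R) = inj₂ r , tab {pArgs r} (λ t → at {pArgs r} R (invTuple σ t))

  module WithΓ (Γ : List Sentence) where

    ConDomSym : DomPerm → Set
    ConDomSym σ = (∀ φ → φ ∈ Γ → act σ φ ∈ Γ)
                × (∀ φ → φ ∈ Γ → Σ[ ψ ∈ Sentence ] (ψ ∈ Γ × act σ ψ ≡ φ))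

    BSet : Set₁
    BSet = Binding → Set

    -- Hyperedges of the microstructure complement of P_FCSP.
    -- (i) {(x,a),(x,b)}, a ≠ b;
    -- (ii) for φ ∈ Γ, the set {(s, α s) | s occurs in φ} for an assignment α
    --      under which φ is false.
    IsEdge : BSet → Set
    IsEdge E =
      (Σ[ x ∈ Symbol ] Σ[ a ∈ Value x ] Σ[ b ∈ Value x ]
         (a ≢ b × (∀ z → E z ⇔ (z ≡ (x , a) ⊎ z ≡ (x , b)))))
      ⊎ (Σ[ φ ∈ Sentence ] Σ[ α ∈ Assignment ]
         (φ ∈ Γ × eval α [] φ ≡ false
          × (∀ z → E z ⇔ (Σ[ s ∈ Symbol ] (s ∈ syms φ × z ≡ (s , α s))))))

    image : (Binding ↔ Binding) → BSet → BSet
    image π E z = Σ[ b ∈ Binding ] (E b × Inverse.to π b ≡ z)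

    -- ConSym(P_FCSP): automorphisms of the microstructure complement.
    ConSym : (Binding ↔ Binding) → Set₁
    ConSym π = ∀ (E : BSet) → (IsEdge E → IsEdge (image π E))
                             × (IsEdge (image π E) → IsEdge E)

    InConDomSymF : (Binding ↔ Binding) → Set
    InConDomSymF π = Σ[ σ ∈ DomPerm ]
                       (ConDomSym σ × (∀ b → Inverse.to π b ≡ ext σ b))

    IsSubgroupOfConSym : Set₁
    IsSubgroupOfConSym =
        (∀ σ → ConDomSym σ →
           Σ[ π ∈ (Binding ↔ Binding) ] (∀ b → Inverse.to π b ≡ ext σ b))
      × (∀ π → InConDomSymF π → ConSym π)
      × InConDomSymF (↔-id Binding)
      × (∀ π ρ → InConDomSymF π → InConDomSymF ρ → InConDomSymF (π ↔-∘ ρ))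
      × (∀ π → InConDomSymF π → InConDomSymF (↔-sym π))

Theorem17 : Set₁
Theorem17 =
  (Sig : Signature) (U : Fin (Signature.nSorts Sig) → ℕ) →
  (∀ θ → NonZero (U θ)) →
  (Γ : List (MSFMF.Sentence Sig U)) →
  MSFMF.WithΓ.IsSubgroupOfConSym Sig U Γ

module Submission where

-- A domain permutation σ transports a structure α to σᶠ α = σ ∘ α ∘ σ⁻¹, and
-- truth is invariant under transporting the structure and the domain constants of
-- a sentence simultaneously.  So if σ • Γ = Γ, σᶠ sends each assignment violating
-- φ ∈ Γ to one violating σ • φ ∈ Γ, on the same scope, and it keeps the symbol of
-- every binding: hyperedges go to hyperedges.  Since σ ↦ σᶠ respects identity,
-- composition and inverses and ConDomSym is a group, the converse direction and
-- the subgroup laws follow.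

open import Defs
open import Data.Nat using (ℕ; NonZero; zero; suc)
open import Data.Fin as F using (Fin)
open import Data.Bool using (Bool; true; false; not; _∧_; _∨_; T)
open import Data.Bool.Properties using (T-∧)
open import Data.List using (List; []; _∷_; _++_)
open import Data.List.Membership.Propositional using (_∈_)
open import Data.List.Relation.Unary.All as All using ([]; _∷_)
open import Data.List.Relation.Unary.All.Properties using (map-cong; map-id; map-∘)
open import Data.Vec using (lookup)
open import Data.Vec.Properties using (tabulate-cong; tabulate∘lookup; lookup∘tabulate)
open import Data.Empty using (⊥-elim)
open import Data.Sum using (_⊎_; inj₁; inj₂)
open import Data.Sum.Function.Propositional using (_⊎-⇔_)
open import Data.Product using (Σ-syntax; _×_; _,_; proj₁; proj₂)
open import Function using (_∘_; id)
open import Function.Bundles using (_↔_; _⇔_; Inverse; Injection; Equivalence; mk⇔; mk↔ₛ′)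
open import Function.Properties.Inverse using (Inverse⇒Injection)
open import Function.Construct.Identity using (↔-id)
open import Function.Construct.Composition using (_↔-∘_; _⇔-∘_)
open import Function.Construct.Symmetry using (↔-sym; ⇔-sym)
open import Relation.Nullary using (does)
open import Relation.Nullary.Decidable using (does-⇔)
open import Relation.Binary.PropositionalEquality

open Equivalence using (to; from)

T-⇔⇒≡ : {b c : Bool} → T b ⇔ T c → b ≡ c
T-⇔⇒≡ {true}  {true}  _   = refl
T-⇔⇒≡ {true}  {false} b⇔c = ⊥-elim (to b⇔c _)
T-⇔⇒≡ {false} {true}  b⇔c = ⊥-elim (from b⇔c _)
T-⇔⇒≡ {false} {false} _   = refl

from≡⇔≡to : ∀ {A B : Set} (π : A ↔ B) {x y} → Inverse.from π x ≡ y ⇔ x ≡ Inverse.to π y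
from≡⇔≡to π = mk⇔ (λ eq → sym (Inverse.inverseˡ π (sym eq))) (Inverse.inverseʳ π)

module _ (Sig : Signature) (U : Fin (Signature.nSorts Sig) → ℕ) where
  open MSFMF Sig U

  T-allFin : ∀ n {p : Fin n → Bool} → T (allFin n p) ⇔ (∀ i → T (p i))
  T-allFin zero    = mk⇔ (λ _ ()) (λ _ → _)
  T-allFin (suc n) = mk⇔
    (λ h → λ { F.zero → proj₁ (to T-∧ h) ; (F.suc i) → to (T-allFin n) (proj₂ (to T-∧ h)) i })
    (λ h → from T-∧ (h F.zero , from (T-allFin n) (h ∘ F.suc)))

  allFin-reindex : ∀ {n} (π : Fin n ↔ Fin n) {p q : Fin n → Bool} →
                   (∀ i → q (Inverse.to π i) ≡ p i) → allFin n q ≡ allFin n p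
  allFin-reindex {n} π {p} {q} q∘π≗p = T-⇔⇒≡ (mk⇔
    (λ allq → from (T-allFin n) λ i → subst T (q∘π≗p i) (to (T-allFin n) allq (Inverse.to π i)))
    (λ allp → from (T-allFin n) λ j →
      subst T (cong q (Inverse.strictlyInverseˡ π j))
        (subst T (sym (q∘π≗p (Inverse.from π j))) (to (T-allFin n) allp (Inverse.from π j)))))

  anyFin≡not-allFin-not : ∀ n (p : Fin n → Bool) → anyFin n p ≡ not (allFin n (not ∘ p))
  anyFin≡not-allFin-not zero    p = refl
  anyFin≡not-allFin-not (suc n) p with p F.zero
  ... | true  = refl
  ... | false = anyFin≡not-allFin-not n (p ∘ F.suc)

  anyFin-reindex : ∀ {n} (π : Fin n ↔ Fin n) {p q : Fin n → Bool} →
                   (∀ i → q (Inverse.to π i) ≡ p i) → anyFin n q ≡ anyFin n p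
  anyFin-reindex {n} π {p} {q} q∘π≗p = begin
    anyFin n q                  ≡⟨ anyFin≡not-allFin-not n q ⟩
    not (allFin n (not ∘ q))    ≡⟨ cong not (allFin-reindex π (cong not ∘ q∘π≗p)) ⟩
    not (allFin n (not ∘ p))    ≡⟨ anyFin≡not-allFin-not n p ⟨
    anyFin n p                  ∎
    where open ≡-Reasoning

  infixr 25 _∘ᵈ_
  infixl 30 _⁻¹ᵈ

  idᵈ : DomPerm
  idᵈ θ = ↔-id (Dom θ)

  _∘ᵈ_ : DomPerm → DomPerm → DomPerm
  (σ ∘ᵈ τ) θ = σ θ ↔-∘ τ θ

  _⁻¹ᵈ : DomPerm → DomPerm
  (σ ⁻¹ᵈ) θ = ↔-sym (σ θ)

  Trivial : DomPerm → Set
  Trivial σ = ∀ θ (d : Dom θ) → Inverse.to (σ θ) d ≡ d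

  ⁻¹ᵈ-∘ᵈ-trivial : ∀ σ → Trivial (σ ⁻¹ᵈ ∘ᵈ σ)
  ⁻¹ᵈ-∘ᵈ-trivial σ θ = Inverse.strictlyInverseʳ (σ θ)

  ∘ᵈ-⁻¹ᵈ-trivial : ∀ σ → Trivial (σ ∘ᵈ σ ⁻¹ᵈ)
  ∘ᵈ-⁻¹ᵈ-trivial σ θ = Inverse.strictlyInverseˡ (σ θ)

  trivial-from : ∀ {σ} → Trivial σ → ∀ θ (d : Dom θ) → Inverse.from (σ θ) d ≡ d
  trivial-from {σ} triv θ d = begin
    Inverse.from (σ θ) d                       ≡⟨ cong (Inverse.from (σ θ)) (triv θ d) ⟨
    Inverse.from (σ θ) (Inverse.to (σ θ) d)    ≡⟨ Inverse.strictlyInverseʳ (σ θ) d ⟩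
    d                                          ∎
    where open ≡-Reasoning

  module DomPermAction {A : Set} (_•_ : DomPerm → A → A)
    (•-∘ᵈ : ∀ σ τ x → (σ ∘ᵈ τ) • x ≡ σ • (τ • x))
    (•-trivial : ∀ {σ} → Trivial σ → ∀ x → σ • x ≡ x) where

    •-id : ∀ x → idᵈ • x ≡ x
    •-id = •-trivial (λ _ _ → refl)

    •-cancelˡ : ∀ σ x → σ ⁻¹ᵈ • (σ • x) ≡ x
    •-cancelˡ σ x = trans (sym (•-∘ᵈ (σ ⁻¹ᵈ) σ x)) (•-trivial (⁻¹ᵈ-∘ᵈ-trivial σ) x)

    •-cancelʳ : ∀ σ x → σ • (σ ⁻¹ᵈ • x) ≡ x
    •-cancelʳ σ x = trans (sym (•-∘ᵈ σ (σ ⁻¹ᵈ) x)) (•-trivial (∘ᵈ-⁻¹ᵈ-trivial σ) x)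

  toTuple : ∀ {as} → DomPerm → Tuple as → Tuple as
  toTuple σ = All.map (λ {θ} → Inverse.to (σ θ))

  invTuple-toTuple : ∀ {as} σ (t : Tuple as) → invTuple σ (toTuple σ t) ≡ t
  invTuple-toTuple σ t =
    trans (map-∘ t) (trans (map-cong t (λ {θ} → Inverse.strictlyInverseʳ (σ θ))) (map-id t))

  invTuple-trivial : ∀ {as σ} → Trivial σ → (t : Tuple as) → invTuple σ t ≡ t
  invTuple-trivial {σ = σ} triv t = trans (map-cong t (λ {θ} → trivial-from {σ} triv θ)) (map-id t)

  at-tab : ∀ {as B} (g : Tuple as → B) t → at {as} (tab {as} g) t ≡ g t
  at-tab {[]}     g []       = refl
  at-tab {a ∷ as} g (x ∷ xs) =
    trans (cong (λ row → at {as} row xs) (lookup∘tabulate _ x)) (at-tab {as} _ xs)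

  tab-cong : ∀ {as B} {g h : Tuple as → B} → (∀ t → g t ≡ h t) → tab {as} g ≡ tab {as} h
  tab-cong {[]}     g≗h = g≗h []
  tab-cong {a ∷ as} g≗h = tabulate-cong (λ x → tab-cong {as} (λ xs → g≗h (x ∷ xs)))

  tab-at : ∀ {as B} (tbl : Table as B) → tab {as} (at {as} tbl) ≡ tbl
  tab-at {[]}     tbl = refl
  tab-at {a ∷ as} tbl = trans (tabulate-cong (λ x → tab-at {as} (lookup tbl x))) (tabulate∘lookup tbl)

  conjugateTable : ∀ {as B} → (Tuple as → Tuple as) → (B → B) → Table as B → Table as B
  conjugateTable {as} k g tbl = tab {as} (λ t → g (at {as} tbl (k t)))

  conjugateTable-∘ : ∀ {as B} {k k′ k″ : Tuple as → Tuple as} {g g′ g″ : B → B} (tbl : Table as B) →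
                     (∀ t → k′ (k t) ≡ k″ t) → (∀ b → g (g′ b) ≡ g″ b) →
                     conjugateTable {as} k g (conjugateTable {as} k′ g′ tbl) ≡ conjugateTable {as} k″ g″ tbl
  conjugateTable-∘ {as} {k = k} {g = g} {g″ = g″} tbl k′∘k≗k″ g∘g′≗g″ = tab-cong {as} λ t →
    trans (cong g (at-tab {as} _ (k t)))
          (trans (g∘g′≗g″ _) (cong (g″ ∘ at {as} tbl) (k′∘k≗k″ t)))

  conjugateTable-id : ∀ {as B} {k : Tuple as → Tuple as} {g : B → B} (tbl : Table as B) →
                      (∀ t → k t ≡ t) → (∀ b → g b ≡ b) → conjugateTable {as} k g tbl ≡ tbl
  conjugateTable-id {as} tbl k≗id g≗id =
    trans (tab-cong {as} (λ t → trans (g≗id _) (cong (at {as} tbl) (k≗id t)))) (tab-at {as} tbl)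

  at-conjugateTable-toTuple : ∀ {as B} σ {g : B → B} (tbl : Table as B) (t : Tuple as) →
    at {as} (conjugateTable {as} (invTuple σ) g tbl) (toTuple σ t) ≡ g (at {as} tbl t)
  at-conjugateTable-toTuple {as} σ {g} tbl t =
    trans (at-tab {as} _ _) (cong (g ∘ at {as} tbl) (invTuple-toTuple σ t))

  extV : DomPerm → (s : Symbol) → Value s → Value s
  extV σ (inj₁ f) = conjugateTable {fArgs f} (invTuple σ) (Inverse.to (σ (fRes f)))
  extV σ (inj₂ r) = conjugateTable {pArgs r} (invTuple σ) id

  ext-extV : ∀ σ s v → ext σ (s , v) ≡ (s , extV σ s v)
  ext-extV σ (inj₁ f) v = refl
  ext-extV σ (inj₂ r) v = refl

  extV-∘ᵈ : ∀ σ τ s v → extV (σ ∘ᵈ τ) s v ≡ extV σ s (extV τ s v)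
  extV-∘ᵈ σ τ (inj₁ f) F = sym (conjugateTable-∘ {fArgs f} {k = invTuple σ} {k′ = invTuple τ}
    {g = Inverse.to (σ (fRes f))} {g′ = Inverse.to (τ (fRes f))} F map-∘ (λ _ → refl))
  extV-∘ᵈ σ τ (inj₂ r) R = sym (conjugateTable-∘ {pArgs r} {k = invTuple σ} {k′ = invTuple τ}
    {g = id} {g′ = id} R map-∘ (λ _ → refl))

  extV-trivial : ∀ {σ} → Trivial σ → ∀ s v → extV σ s v ≡ v
  extV-trivial {σ} triv (inj₁ f) F =
    conjugateTable-id {fArgs f} F (invTuple-trivial {σ = σ} triv) (triv (fRes f))
  extV-trivial {σ} triv (inj₂ r) R =
    conjugateTable-id {pArgs r} R (invTuple-trivial {σ = σ} triv) (λ _ → refl)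

  module ExtV (s : Symbol) = DomPermAction (λ σ → extV σ s) (λ σ τ → extV-∘ᵈ σ τ s)
                                           (λ triv → extV-trivial triv s)

  ext-∘ᵈ : ∀ σ τ b → ext (σ ∘ᵈ τ) b ≡ ext σ (ext τ b)
  ext-∘ᵈ σ τ (inj₁ f , F) = cong (inj₁ f ,_) (extV-∘ᵈ σ τ (inj₁ f) F)
  ext-∘ᵈ σ τ (inj₂ r , R) = cong (inj₂ r ,_) (extV-∘ᵈ σ τ (inj₂ r) R)

  ext-trivial : ∀ {σ} → Trivial σ → ∀ b → ext σ b ≡ b
  ext-trivial {σ} triv (inj₁ f , F) = cong (inj₁ f ,_) (extV-trivial {σ} triv (inj₁ f) F)
  ext-trivial {σ} triv (inj₂ r , R) = cong (inj₂ r ,_) (extV-trivial {σ} triv (inj₂ r) R)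

  module Ext = DomPermAction ext ext-∘ᵈ ext-trivial

  extPerm : DomPerm → Binding ↔ Binding
  extPerm σ = mk↔ₛ′ (ext σ) (ext (σ ⁻¹ᵈ)) (Ext.•-cancelʳ σ) (Ext.•-cancelˡ σ)

  from≗ext-⁻¹ᵈ : ∀ {σ} {π : Binding ↔ Binding} → (∀ b → Inverse.to π b ≡ ext σ b) →
                 ∀ b → Inverse.from π b ≡ ext (σ ⁻¹ᵈ) b
  from≗ext-⁻¹ᵈ {σ} {π} π≗σᶠ b = from (from≡⇔≡to π) (sym (trans (π≗σᶠ _) (Ext.•-cancelʳ σ b)))

  mutual
    actT-∘ᵈ : ∀ {Δ θ} σ τ (t : Term Δ θ) → actT (σ ∘ᵈ τ) t ≡ actT σ (actT τ t)
    actT-∘ᵈ σ τ (var v)    = refl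
    actT-∘ᵈ σ τ (val d)    = refl
    actT-∘ᵈ σ τ (app f ts) = cong (app f) (actTs-∘ᵈ σ τ ts)

    actTs-∘ᵈ : ∀ {Δ θs} σ τ (ts : Terms Δ θs) → actTs (σ ∘ᵈ τ) ts ≡ actTs σ (actTs τ ts)
    actTs-∘ᵈ σ τ []       = refl
    actTs-∘ᵈ σ τ (t ∷ ts) = cong₂ _∷_ (actT-∘ᵈ σ τ t) (actTs-∘ᵈ σ τ ts)

  act-∘ᵈ : ∀ {Δ} σ τ (φ : Formula Δ) → act (σ ∘ᵈ τ) φ ≡ act σ (act τ φ)
  act-∘ᵈ σ τ tt          = refl
  act-∘ᵈ σ τ ff          = refl
  act-∘ᵈ σ τ (t ≐ u)     = cong₂ _≐_ (actT-∘ᵈ σ τ t) (actT-∘ᵈ σ τ u)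
  act-∘ᵈ σ τ (pred r ts) = cong (pred r) (actTs-∘ᵈ σ τ ts)
  act-∘ᵈ σ τ (¬' φ)      = cong ¬'_ (act-∘ᵈ σ τ φ)
  act-∘ᵈ σ τ (φ ∧' ψ)    = cong₂ _∧'_ (act-∘ᵈ σ τ φ) (act-∘ᵈ σ τ ψ)
  act-∘ᵈ σ τ (φ ∨' ψ)    = cong₂ _∨'_ (act-∘ᵈ σ τ φ) (act-∘ᵈ σ τ ψ)
  act-∘ᵈ σ τ (φ ⇒' ψ)    = cong₂ _⇒'_ (act-∘ᵈ σ τ φ) (act-∘ᵈ σ τ ψ)
  act-∘ᵈ σ τ (φ ⇔' ψ)    = cong₂ _⇔'_ (act-∘ᵈ σ τ φ) (act-∘ᵈ σ τ ψ)
  act-∘ᵈ σ τ (all' θ φ)  = cong (all' θ) (act-∘ᵈ σ τ φ)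
  act-∘ᵈ σ τ (ex' θ φ)   = cong (ex' θ) (act-∘ᵈ σ τ φ)

  module _ {σ : DomPerm} (triv : Trivial σ) where
    mutual
      actT-trivial : ∀ {Δ θ} (t : Term Δ θ) → actT σ t ≡ t
      actT-trivial (var v)       = refl
      actT-trivial (val {θ} d)   = cong val (triv θ d)
      actT-trivial (app f ts)    = cong (app f) (actTs-trivial ts)

      actTs-trivial : ∀ {Δ θs} (ts : Terms Δ θs) → actTs σ ts ≡ ts
      actTs-trivial []       = refl
      actTs-trivial (t ∷ ts) = cong₂ _∷_ (actT-trivial t) (actTs-trivial ts)

    act-trivial : ∀ {Δ} (φ : Formula Δ) → act σ φ ≡ φ
    act-trivial tt          = refl
    act-trivial ff          = refl
    act-trivial (t ≐ u)     = cong₂ _≐_ (actT-trivial t) (actT-trivial u)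
    act-trivial (pred r ts) = cong (pred r) (actTs-trivial ts)
    act-trivial (¬' φ)      = cong ¬'_ (act-trivial φ)
    act-trivial (φ ∧' ψ)    = cong₂ _∧'_ (act-trivial φ) (act-trivial ψ)
    act-trivial (φ ∨' ψ)    = cong₂ _∨'_ (act-trivial φ) (act-trivial ψ)
    act-trivial (φ ⇒' ψ)    = cong₂ _⇒'_ (act-trivial φ) (act-trivial ψ)
    act-trivial (φ ⇔' ψ)    = cong₂ _⇔'_ (act-trivial φ) (act-trivial ψ)
    act-trivial (all' θ φ)  = cong (all' θ) (act-trivial φ)
    act-trivial (ex' θ φ)   = cong (ex' θ) (act-trivial φ)

  module Act = DomPermAction (act {[]}) act-∘ᵈ (λ triv → act-trivial triv)

  mutual
    symsT-actT : ∀ {Δ θ} σ (t : Term Δ θ) → symsT (actT σ t) ≡ symsT t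
    symsT-actT σ (var v)    = refl
    symsT-actT σ (val d)    = refl
    symsT-actT σ (app f ts) = cong (inj₁ f ∷_) (symsTs-actTs σ ts)

    symsTs-actTs : ∀ {Δ θs} σ (ts : Terms Δ θs) → symsTs (actTs σ ts) ≡ symsTs ts
    symsTs-actTs σ []       = refl
    symsTs-actTs σ (t ∷ ts) = cong₂ _++_ (symsT-actT σ t) (symsTs-actTs σ ts)

  syms-act : ∀ {Δ} σ (φ : Formula Δ) → syms (act σ φ) ≡ syms φ
  syms-act σ tt          = refl
  syms-act σ ff          = refl
  syms-act σ (t ≐ u)     = cong₂ _++_ (symsT-actT σ t) (symsT-actT σ u)
  syms-act σ (pred r ts) = cong (inj₂ r ∷_) (symsTs-actTs σ ts)
  syms-act σ (¬' φ)      = syms-act σ φ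
  syms-act σ (φ ∧' ψ)    = cong₂ _++_ (syms-act σ φ) (syms-act σ ψ)
  syms-act σ (φ ∨' ψ)    = cong₂ _++_ (syms-act σ φ) (syms-act σ ψ)
  syms-act σ (φ ⇒' ψ)    = cong₂ _++_ (syms-act σ φ) (syms-act σ ψ)
  syms-act σ (φ ⇔' ψ)    = cong₂ _++_ (syms-act σ φ) (syms-act σ ψ)
  syms-act σ (all' θ φ)  = syms-act σ φ
  syms-act σ (ex' θ φ)   = syms-act σ φ

  extA : DomPerm → Assignment → Assignment
  extA σ α s = extV σ s (α s)

  lookupVar-toTuple : ∀ {Δ θ} σ (ρ : Tuple Δ) (v : Var Δ θ) →
                      lookupVar (toTuple σ ρ) v ≡ Inverse.to (σ θ) (lookupVar ρ v)
  lookupVar-toTuple σ (x ∷ ρ) here      = refl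
  lookupVar-toTuple σ (x ∷ ρ) (there v) = lookupVar-toTuple σ ρ v

  mutual
    evalTerm-actT : ∀ {Δ θ} σ α (ρ : Tuple Δ) (t : Term Δ θ) →
      evalTerm (extA σ α) (toTuple σ ρ) (actT σ t) ≡ Inverse.to (σ θ) (evalTerm α ρ t)
    evalTerm-actT σ α ρ (var v)    = lookupVar-toTuple σ ρ v
    evalTerm-actT σ α ρ (val d)    = refl
    evalTerm-actT σ α ρ (app f ts) =
      trans (cong (at {fArgs f} (extA σ α (inj₁ f))) (evalTerms-actTs σ α ρ ts))
            (at-conjugateTable-toTuple {fArgs f} σ {Inverse.to (σ (fRes f))} (α (inj₁ f)) (evalTerms α ρ ts))

    evalTerms-actTs : ∀ {Δ θs} σ α (ρ : Tuple Δ) (ts : Terms Δ θs) →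
      evalTerms (extA σ α) (toTuple σ ρ) (actTs σ ts) ≡ toTuple σ (evalTerms α ρ ts)
    evalTerms-actTs σ α ρ []       = refl
    evalTerms-actTs σ α ρ (t ∷ ts) = cong₂ _∷_ (evalTerm-actT σ α ρ t) (evalTerms-actTs σ α ρ ts)

  does-≟-to : ∀ {n} (π : Fin n ↔ Fin n) (x y : Fin n) →
              does (Inverse.to π x F.≟ Inverse.to π y) ≡ does (x F.≟ y)
  does-≟-to π x y =
    does-⇔ (mk⇔ (Injection.injective (Inverse⇒Injection π)) (cong (Inverse.to π))) (_ F.≟ _) (x F.≟ y)

  eval-act : ∀ {Δ} σ α (ρ : Tuple Δ) (φ : Formula Δ) →
             eval (extA σ α) (toTuple σ ρ) (act σ φ) ≡ eval α ρ φ
  eval-act σ α ρ tt          = refl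
  eval-act σ α ρ ff          = refl
  eval-act σ α ρ (_≐_ {θ} t u) =
    trans (cong₂ (λ a b → does (a F.≟ b)) (evalTerm-actT σ α ρ t) (evalTerm-actT σ α ρ u))
          (does-≟-to (σ θ) _ _)
  eval-act σ α ρ (pred r ts) =
    trans (cong (at {pArgs r} (extA σ α (inj₂ r))) (evalTerms-actTs σ α ρ ts))
          (at-conjugateTable-toTuple {pArgs r} σ {id} (α (inj₂ r)) (evalTerms α ρ ts))
  eval-act σ α ρ (¬' φ)      = cong not (eval-act σ α ρ φ)
  eval-act σ α ρ (φ ∧' ψ)    = cong₂ _∧_ (eval-act σ α ρ φ) (eval-act σ α ρ ψ)
  eval-act σ α ρ (φ ∨' ψ)    = cong₂ _∨_ (eval-act σ α ρ φ) (eval-act σ α ρ ψ)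
  eval-act σ α ρ (φ ⇒' ψ)    = cong₂ (λ a b → not a ∨ b) (eval-act σ α ρ φ) (eval-act σ α ρ ψ)
  eval-act σ α ρ (φ ⇔' ψ)    = cong₂ _⇔b_ (eval-act σ α ρ φ) (eval-act σ α ρ ψ)
  eval-act σ α ρ (all' θ φ)  = allFin-reindex (σ θ) (λ d → eval-act σ α (d ∷ ρ) φ)
  eval-act σ α ρ (ex' θ φ)   = anyFin-reindex (σ θ) (λ d → eval-act σ α (d ∷ ρ) φ)

  module _ (Γ : List Sentence) where
    open WithΓ Γ

    ConDomSym-idᵈ : ConDomSym idᵈ
    ConDomSym-idᵈ = (λ φ φ∈Γ → subst (_∈ Γ) (sym (Act.•-id φ)) φ∈Γ)
                  , (λ φ φ∈Γ → φ , φ∈Γ , Act.•-id φ)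

    ConDomSym-∘ᵈ : ∀ {σ τ} → ConDomSym σ → ConDomSym τ → ConDomSym (σ ∘ᵈ τ)
    ConDomSym-∘ᵈ {σ} {τ} (σΓ⊆Γ , Γ⊆σΓ) (τΓ⊆Γ , Γ⊆τΓ) =
      (λ φ φ∈Γ → subst (_∈ Γ) (sym (act-∘ᵈ σ τ φ)) (σΓ⊆Γ _ (τΓ⊆Γ φ φ∈Γ))) ,
      λ φ φ∈Γ → let (ψ , ψ∈Γ , σψ≡φ) = Γ⊆σΓ φ φ∈Γ
                    (χ , χ∈Γ , τχ≡ψ) = Γ⊆τΓ ψ ψ∈Γ
                in χ , χ∈Γ , trans (act-∘ᵈ σ τ χ) (trans (cong (act σ) τχ≡ψ) σψ≡φ)

    ConDomSym-⁻¹ᵈ : ∀ {σ} → ConDomSym σ → ConDomSym (σ ⁻¹ᵈ)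
    ConDomSym-⁻¹ᵈ {σ} (σΓ⊆Γ , Γ⊆σΓ) =
      (λ φ φ∈Γ → let (ψ , ψ∈Γ , σψ≡φ) = Γ⊆σΓ φ φ∈Γ in
                 subst (_∈ Γ) (trans (sym (Act.•-cancelˡ σ ψ)) (cong (act (σ ⁻¹ᵈ)) σψ≡φ)) ψ∈Γ) ,
      λ φ φ∈Γ → act σ φ , σΓ⊆Γ φ φ∈Γ , Act.•-cancelˡ σ φ

    IsEdge-resp : ∀ {E E′ : BSet} → (∀ z → E z ⇔ E′ z) → IsEdge E → IsEdge E′
    IsEdge-resp E⇔E′ (inj₁ (x , a , b , a≢b , E≐)) =
      inj₁ (x , a , b , a≢b , λ z → E≐ z ⇔-∘ ⇔-sym (E⇔E′ z))
    IsEdge-resp E⇔E′ (inj₂ (φ , α , φ∈Γ , φ-false , E≐)) =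
      inj₂ (φ , α , φ∈Γ , φ-false , λ z → E≐ z ⇔-∘ ⇔-sym (E⇔E′ z))

    image-⇔ : ∀ (π : Binding ↔ Binding) E z → image π E z ⇔ E (Inverse.from π z)
    image-⇔ π E z = mk⇔
      (λ (b , Eb , πb≡z) → subst E (sym (from (from≡⇔≡to π) (sym πb≡z))) Eb)
      (λ E[π⁻¹z] → Inverse.from π z , E[π⁻¹z] , Inverse.strictlyInverseˡ π z)

    module _ {σ : DomPerm} {π : Binding ↔ Binding} (π≗σᶠ : ∀ b → Inverse.to π b ≡ ext σ b) where

      to-binding : ∀ s v → Inverse.to π (s , v) ≡ (s , extV σ s v)
      to-binding s v = trans (π≗σᶠ (s , v)) (ext-extV σ s v)

      from≡⇔≡binding : ∀ {z} s v → Inverse.from π z ≡ (s , v) ⇔ z ≡ (s , extV σ s v)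
      from≡⇔≡binding s v = mk⇔
        (λ eq → trans (to (from≡⇔≡to π) eq) (to-binding s v))
        (λ eq → from (from≡⇔≡to π) (trans eq (sym (to-binding s v))))

      pair-edge-image : ∀ {E : BSet} x a b →
        (∀ z → E z ⇔ (z ≡ (x , a) ⊎ z ≡ (x , b))) →
        ∀ z → image π E z ⇔ (z ≡ (x , extV σ x a) ⊎ z ≡ (x , extV σ x b))
      pair-edge-image {E} x a b E≐ z =
        (from≡⇔≡binding x a ⊎-⇔ from≡⇔≡binding x b) ⇔-∘ (E≐ (Inverse.from π z) ⇔-∘ image-⇔ π E z)

      constraint-edge-image : ∀ {E : BSet} (φ : Sentence) α →
        (∀ z → E z ⇔ (Σ[ s ∈ Symbol ] (s ∈ syms φ × z ≡ (s , α s)))) →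
        ∀ z → image π E z ⇔ (Σ[ s ∈ Symbol ] (s ∈ syms (act σ φ) × z ≡ (s , extA σ α s)))
      constraint-edge-image {E} φ α E≐ z = scope-⇔ ⇔-∘ (E≐ (Inverse.from π z) ⇔-∘ image-⇔ π E z)
        where
        scope-⇔ : (Σ[ s ∈ Symbol ] (s ∈ syms φ × Inverse.from π z ≡ (s , α s)))
                ⇔ (Σ[ s ∈ Symbol ] (s ∈ syms (act σ φ) × z ≡ (s , extA σ α s)))
        scope-⇔ = mk⇔
          (λ (s , s∈φ , eq) → s , subst (s ∈_) (sym (syms-act σ φ)) s∈φ , to (from≡⇔≡binding s (α s)) eq)
          (λ (s , s∈σφ , eq) → s , subst (s ∈_) (syms-act σ φ) s∈σφ , from (from≡⇔≡binding s (α s)) eq)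

      image-edge : ConDomSym σ → ∀ {E} → IsEdge E → IsEdge (image π E)
      image-edge _ (inj₁ (x , a , b , a≢b , E≐)) =
        inj₁ (x , extV σ x a , extV σ x b , σa≢σb , pair-edge-image x a b E≐)
        where
        σa≢σb : extV σ x a ≢ extV σ x b
        σa≢σb eq = a≢b (begin
          a                                    ≡⟨ ExtV.•-cancelˡ x σ a ⟨
          extV (σ ⁻¹ᵈ) x (extV σ x a)          ≡⟨ cong (extV (σ ⁻¹ᵈ) x) eq ⟩
          extV (σ ⁻¹ᵈ) x (extV σ x b)          ≡⟨ ExtV.•-cancelˡ x σ b ⟩
          b                                    ∎)
          where open ≡-Reasoning
      image-edge (σΓ⊆Γ , _) (inj₂ (φ , α , φ∈Γ , φ-false , E≐)) =
        inj₂ (act σ φ , extA σ α , σΓ⊆Γ φ φ∈Γ , trans (eval-act σ α [] φ) φ-false ,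
              constraint-edge-image φ α E≐)

    preimage-edge : ∀ {σ} {π : Binding ↔ Binding} → (∀ b → Inverse.to π b ≡ ext σ b) →
                    ConDomSym σ → ∀ {E} → IsEdge (image π E) → IsEdge E
    preimage-edge {σ} {π} π≗σᶠ σ∈ {E} πE-edge =
      IsEdge-resp image-image
        (image-edge {σ ⁻¹ᵈ} {↔-sym π} (from≗ext-⁻¹ᵈ {σ} {π} π≗σᶠ) (ConDomSym-⁻¹ᵈ σ∈) πE-edge)
      where
      image-image : ∀ z → image (↔-sym π) (image π E) z ⇔ E z
      image-image z = mk⇔ (subst E (Inverse.strictlyInverseʳ π z))
                          (subst E (sym (Inverse.strictlyInverseʳ π z)))
                      ⇔-∘ (image-⇔ π E (Inverse.to π z) ⇔-∘ image-⇔ (↔-sym π) (image π E) z)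

    InConDomSymF⇒ConSym : ∀ π → InConDomSymF π → ConSym π
    InConDomSymF⇒ConSym π (σ , σ∈ , π≗σᶠ) E =
      image-edge {σ} {π} π≗σᶠ σ∈ , preimage-edge {σ} {π} π≗σᶠ σ∈

    InConDomSymF-id : InConDomSymF (↔-id Binding)
    InConDomSymF-id = idᵈ , ConDomSym-idᵈ , λ b → sym (Ext.•-id b)

    InConDomSymF-∘ : ∀ π ρ → InConDomSymF π → InConDomSymF ρ → InConDomSymF (π ↔-∘ ρ)
    InConDomSymF-∘ π ρ (σ , σ∈ , π≗σᶠ) (τ , τ∈ , ρ≗τᶠ) =
      σ ∘ᵈ τ , ConDomSym-∘ᵈ σ∈ τ∈ ,
      λ b → trans (cong (Inverse.to π) (ρ≗τᶠ b)) (trans (π≗σᶠ _) (sym (ext-∘ᵈ σ τ b)))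

    InConDomSymF-⁻¹ : ∀ π → InConDomSymF π → InConDomSymF (↔-sym π)
    InConDomSymF-⁻¹ π (σ , σ∈ , π≗σᶠ) = σ ⁻¹ᵈ , ConDomSym-⁻¹ᵈ σ∈ , from≗ext-⁻¹ᵈ {σ} {π} π≗σᶠ

    isSubgroupOfConSym : IsSubgroupOfConSym
    isSubgroupOfConSym = (λ σ _ → extPerm σ , λ _ → refl)
                       , InConDomSymF⇒ConSym
                       , InConDomSymF-id
                       , InConDomSymF-∘
                       , InConDomSymF-⁻¹

mainTheorem17 : (Sig : Signature) (U : Fin (Signature.nSorts Sig) → ℕ) →
    (∀ θ → NonZero (U θ)) →
    (Γ : List (MSFMF.Sentence Sig U)) →
    MSFMF.WithΓ.IsSubgroupOfConSym Sig U Γ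
mainTheorem17 Sig U _ Γ = isSubgroupOfConSym Sig U Γ
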